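{- Let $d\ge2$ be an integer, $n_1,\dots,n_d\in\mathbb{N}$ and $\epsilon\in(0,1)$. If $\frac1\epsilon\le n_i$ for all $1\le i\le d$, then there are at most $6^d\epsilon n_1\cdots n_d$ nonzero integer points $(b_1,\dots,b_d)\in[-n_1,n_1]\times\cdots\times[-n_d,n_d]$ with $|b_i/\gcd(b_1,\dots,b_d)|\le\epsilon n_i$ for all $1\le i\le d$.
   Formalization: The parameter ε ranges over the rationals in $(0,1)$. -}

module Defs where

open import Data.Nat as ℕ using (ℕ; zero; suc)
open import Data.Nat.GCD using (gcd)
open import Data.Integer as ℤ using (ℤ; +_; ∣_∣)
open import Data.Rational as ℚ using (ℚ; 0ℚ; 1/_; _/_; positive)
open import Data.Rational.Properties using (pos⇒nonZero)
open import Data.Vec using (Vec; foldr)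

gcdVec : ∀ {d} → Vec ℤ d → ℕ
gcdVec = foldr _ (λ b g → gcd ∣ b ∣ g) 0

-- the rational number m / g  (junk value 0 when g = 0; only used for nonzero points, where g ≥ 1)
divℚ : ℕ → ℕ → ℚ
divℚ m zero    = 0ℚ
divℚ m (suc k) = (+ m) / suc k

inv : (ε : ℚ) → 0ℚ ℚ.< ε → ℚ
inv ε h = (1/ ε) {{pos⇒nonZero ε {{positive h}}}}

ℕtoℚ : ℕ → ℚ
ℕtoℚ k = (+ k) / 1

prodVec : ∀ {d} → Vec ℕ d → ℕ
prodVec = foldr _ ℕ._*_ 1

-- Write an admissible point as b = g a with g = gcd b, so that |aᵢ| ≤ ε nᵢ and g |aᵢ| ≤ nᵢ.
-- A point on the j-th axis is one of 2 nⱼ ≤ 2 ε nⱼ nₖ integers, for any k ≠ j (this needs d ≥ 2).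
-- Otherwise pick nonzero coordinates j ≠ k with |aₖ| / nₖ ≤ |aⱼ| / nⱼ: then b is determined by
-- aⱼ (at most 2 ε nⱼ choices), the pair (g, aₖ) with g ≤ nⱼ / |aⱼ| and |aₖ| ≤ nₖ |aⱼ| / nⱼ
-- (at most 2 nₖ choices together) and the other coordinates of a (at most ∏ (2 nᵢ + 1) ≤ ∏ 3 nᵢ).
-- Each of the d (d + 1) cases thus has at most (4/9) ε 3ᵈ ∏ nᵢ points, and d (d + 1) ≤ 2ᵈ⁺¹.
module Submission where

open import Defs

open import Data.Empty using (⊥-elim)
open import Data.Fin as Fin using (Fin; zero; suc; punchIn)
open import Data.Fin.Properties using (punchInᵢ≢i; ¬∀⟶∃¬; any?)
open import Data.Integer as ℤ using (ℤ; +_; -[1+_]; +≤+; ∣_∣; sign; _◃_)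
open import Data.Integer.Properties using (◃-inverse; ◃-distrib-*; +◃n≡+n; abs-◃; ∣i∣≡0⇒i≡0; pos-*; drop‿+≤+)
open import Data.List using (List; []; _∷_; length)
open import Data.List.Relation.Unary.All as All using (All; []; _∷_)
open import Data.List.Relation.Unary.AllPairs using ([]; _∷_)
open import Data.List.Relation.Unary.Unique.Propositional using (Unique)
open import Data.Nat as ℕ
open import Data.Nat.Coprimality using (Coprime)
open import Data.Nat.Divisibility using (_∣_; quotient; ∣-trans; 0∣⇒≡0)
open import Data.Nat.DivMod using (_/_; m/n*n≤m; m*n/n≡m; /-monoˡ-≤)
open import Data.Nat.GCD using (gcd[m,n]∣m; gcd[m,n]∣n)
open import Data.Nat.Properties
open import Algebra.Properties.CommutativeSemigroup *-commutativeSemigroup using (interchange)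
open import Data.Nat.Tactic.RingSolver using (solve-∀)
open import Data.Product using (_×_; _,_; proj₁; proj₂; ∃)
import Data.Product.Properties as Product
open import Data.Rational as ℚ using (ℚ; mkℚ; 0ℚ; 1ℚ; toℚᵘ; *<*)
open import Data.Rational.Properties using (toℚᵘ-mono-≤; toℚᵘ-cancel-≤; toℚᵘ-fromℚᵘ; toℚᵘ-homo-*)
open import Data.Rational.Unnormalised as ℚᵘ using (ℚᵘ; mkℚᵘ; *≤*; ↥_; ↧ₙ_)
import Data.Rational.Unnormalised.Properties as ℚᵘ
open import Data.Sign as Sign using (Sign)
import Data.Sign.Properties as Sign
open import Data.Sum as Sum using (inj₁; inj₂)
open import Data.Vec using (Vec; []; _∷_; lookup; map; replicate; tabulate; uncons; _[_]≔_)
open import Data.Vec.Properties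
  using (∷-injectiveˡ; ∷-injectiveʳ; lookup∘tabulate; lookup∘update′; lookup-map; lookup-replicate; map-[]≔)
open import Data.Vec.Relation.Binary.Pointwise.Extensional using (ext; Pointwise-≡⇒≡)
open import Function using (_∘_)
open import Level using (0ℓ)
open import Relation.Binary.Definitions using (DecidableEquality)
open import Relation.Binary.PropositionalEquality
open import Relation.Nullary using (¬_; yes; no; ¬?; _×-dec_; contradiction)
open import Relation.Nullary.Decidable using (decidable-stable)
open import Relation.Unary using (Pred; ∅; _⊆_; _∪_; _∖_; ｛_｝; ⋃; _⟨×⟩_)

private
  variable
    A B : Set
    P Q R : Pred A 0ℓ
    M N : ℕ

-- Finite counting

AtMost : ℕ → Pred A 0ℓ → Set
AtMost N P = ∀ {xs} → Unique xs → All P xs → length xs ≤ N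

atMost-mono : M ≤ N → P ⊆ Q → AtMost M Q → AtMost N P
atMost-mono M≤N P⊆Q #Q u ps = ≤-trans (#Q u (All.map P⊆Q ps)) M≤N

atMost-∅ : AtMost N (∅ {A = A})
atMost-∅ [] [] = z≤n

atMost-｛｝ : (x : A) → AtMost 1 ｛ x ｝
atMost-｛｝ x [] [] = z≤n
atMost-｛｝ x (_ ∷ []) _ = s≤s z≤n
atMost-｛｝ x ((y≢z ∷ _) ∷ _) (refl ∷ refl ∷ _) = ⊥-elim (y≢z refl)

atMost-0⇒¬ : ∀ {x} → AtMost 0 P → ¬ P x
atMost-0⇒¬ #P px with #P ([] ∷ []) (px ∷ [])
... | ()

atMost-∖ : ∀ {x} → P x → AtMost (suc N) P → AtMost N (P ∖ ｛ x ｝)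
atMost-∖ px #P u ps = ≤-pred (#P (All.map proj₂ ps ∷ u) (px ∷ All.map proj₁ ps))

private
  ⊆∪-∖ˡ : ∀ x → P ⊆ Q ∪ R → P ∖ ｛ x ｝ ⊆ (Q ∖ ｛ x ｝) ∪ R
  ⊆∪-∖ˡ _ P⊆Q∪R (py , x≢y) = Sum.map₁ (_, x≢y) (P⊆Q∪R py)

  ⊆∪-∖ʳ : ∀ x → P ⊆ Q ∪ R → P ∖ ｛ x ｝ ⊆ Q ∪ (R ∖ ｛ x ｝)
  ⊆∪-∖ʳ _ P⊆Q∪R (py , x≢y) = Sum.map₂ (_, x≢y) (P⊆Q∪R py)

atMost-⊆∪ : P ⊆ Q ∪ R → AtMost M Q → AtMost N R → AtMost (M + N) P
atMost-⊆∪ P⊆Q∪R #Q #R [] [] = z≤n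
atMost-⊆∪ {P = P} {Q = Q} {R = R} {M = M} {N = N} P⊆Q∪R #Q #R {x ∷ _} (x∉xs ∷ u) (px ∷ ps)
  with P⊆Q∪R px | M | #Q | N | #R
... | inj₁ qx | zero   | #Q | _ | _  = ⊥-elim (atMost-0⇒¬ #Q qx)
... | inj₁ qx | suc M′ | #Q | _ | #R =
  s≤s (atMost-⊆∪ (⊆∪-∖ˡ {P = P} {Q = Q} {R = R} x P⊆Q∪R) (atMost-∖ qx #Q) #R u (All.zip (ps , x∉xs)))
... | inj₂ rx | _ | _  | zero   | #R = ⊥-elim (atMost-0⇒¬ #R rx)
... | inj₂ rx | M′ | #Q | suc N′ | #R = ≤-trans
  (s≤s (atMost-⊆∪ (⊆∪-∖ʳ {P = P} {Q = Q} {R = R} x P⊆Q∪R) #Q (atMost-∖ rx #R) u (All.zip (ps , x∉xs))))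
  (≤-reflexive (sym (+-suc M′ N′)))

atMost-∪ : AtMost M Q → AtMost N R → AtMost (M + N) (Q ∪ R)
atMost-∪ = atMost-⊆∪ (λ q∪r → q∪r)

atMost-inject : (f : A → B) → (∀ {x y} → P x → P y → f x ≡ f y → x ≡ y) → (∀ {x} → P x → Q (f x)) →
                AtMost N Q → AtMost N P
atMost-inject f inj P⇒Q∘f #Q [] [] = z≤n
atMost-inject {P = P} {Q = Q} {N = N} f inj P⇒Q∘f #Q {x ∷ _} (x∉xs ∷ u) (px ∷ ps) with N | #Q
... | zero   | #Q = ⊥-elim (atMost-0⇒¬ #Q (P⇒Q∘f px))
... | suc N′ | #Q = s≤s (atMost-inject f inj′ P⇒Q∘f′ (atMost-∖ (P⇒Q∘f px) #Q) u (All.zip (ps , x∉xs)))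
  where
  inj′ : ∀ {y z} → (P ∖ ｛ x ｝) y → (P ∖ ｛ x ｝) z → f y ≡ f z → y ≡ z
  inj′ (py , _) (pz , _) = inj py pz
  P⇒Q∘f′ : ∀ {y} → (P ∖ ｛ x ｝) y → (Q ∖ ｛ f x ｝) (f y)
  P⇒Q∘f′ (py , x≢y) = P⇒Q∘f py , λ fx≡fy → x≢y (inj px py fx≡fy)

infixr 2 _⟨Σ⟩_
_⟨Σ⟩_ : Pred A 0ℓ → (A → Pred B 0ℓ) → Pred (A × B) 0ℓ
(P ⟨Σ⟩ Q) (a , b) = P a × Q a b

atMost-Σ : {Q : A → Pred B 0ℓ} → DecidableEquality A →
           AtMost M P → (∀ {a} → P a → AtMost N (Q a)) → AtMost (M * N) (P ⟨Σ⟩ Q)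
atMost-Σ _≟_ #P #Q [] [] = z≤n
atMost-Σ {M = zero} _≟_ #P #Q _ ((pa , _) ∷ _) = ⊥-elim (atMost-0⇒¬ #P pa)
atMost-Σ {A = A} {B = B} {M = suc M} {P = P} {Q = Q} _≟_ #P #Q {(a , _) ∷ _} u ps@((pa , _) ∷ _) =
  atMost-⊆∪ split (atMost-inject proj₂ inj proj₂ (#Q pa)) (atMost-Σ _≟_ (atMost-∖ pa #P) (#Q ∘ proj₁)) u ps
  where
  Fibre : Pred (A × B) 0ℓ
  Fibre (a′ , b) = a ≡ a′ × Q a b
  split : (P ⟨Σ⟩ Q) ⊆ Fibre ∪ ((P ∖ ｛ a ｝) ⟨Σ⟩ Q)
  split {a′ , b} (pa′ , qb) with a ≟ a′
  ... | yes refl = inj₁ (refl , qb)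
  ... | no a≢a′  = inj₂ ((pa′ , a≢a′) , qb)
  inj : ∀ {x y} → Fibre x → Fibre y → proj₂ x ≡ proj₂ y → x ≡ y
  inj (refl , _) (refl , _) refl = refl

atMost-⋃ : ∀ d {Q : Fin d → Pred A 0ℓ} → (∀ i → AtMost N (Q i)) → AtMost (d * N) (⋃ (Fin d) Q)
atMost-⋃ zero    #Q = atMost-mono z≤n (λ ()) atMost-∅
atMost-⋃ (suc d) {Q} #Q = atMost-⊆∪ split (#Q zero) (atMost-⋃ d (#Q ∘ suc))
  where
  split : ⋃ (Fin (suc d)) Q ⊆ Q zero ∪ ⋃ (Fin d) (Q ∘ suc)
  split (zero , q)  = inj₁ q
  split (suc i , q) = inj₂ (i , q)

m*n≤o⇒n≤o/m : ∀ m n o .{{_ : NonZero m}} → m * n ≤ o → n ≤ o / m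
m*n≤o⇒n≤o/m m n o m*n≤o = subst (_≤ o / m) (m*n/n≡m n m) (/-monoˡ-≤ m (subst (_≤ o) (*-comm m n) m*n≤o))

[m/n]*[o*n/m]≤o : ∀ m n o .{{_ : NonZero m}} .{{_ : NonZero n}} → (m / n) * (o * n / m) ≤ o
[m/n]*[o*n/m]≤o m n o = *-cancelʳ-≤ (m / n * (o * n / m)) o (n * m) {{m*n≢0 n m}} (begin
  m / n * (o * n / m) * (n * m)  ≡⟨ interchange (m / n) (o * n / m) n m ⟩
  (m / n * n) * (o * n / m * m)  ≤⟨ *-mono-≤ (m/n*n≤m m n) (m/n*n≤m (o * n) m) ⟩
  m * (o * n)                    ≡⟨ rearrange m n o ⟩
  o * (n * m)                    ∎)
  where
  open ≤-Reasoning
  rearrange : ∀ m n o → m * (o * n) ≡ o * (n * m)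
  rearrange = solve-∀

^-distribʳ-* : ∀ m n o → (m * n) ^ o ≡ m ^ o * n ^ o
^-distribʳ-* m n zero    = refl
^-distribʳ-* m n (suc o) = begin
  m * n * (m * n) ^ o      ≡⟨ cong (m * n *_) (^-distribʳ-* m n o) ⟩
  m * n * (m ^ o * n ^ o)  ≡⟨ interchange m n (m ^ o) (n ^ o) ⟩
  m * m ^ o * (n * n ^ o)  ∎
  where open ≡-Reasoning

n<2^n : ∀ n → n < 2 ^ n
n<2^n zero    = s≤s z≤n
n<2^n (suc n) = begin-strict
  suc n          ≤⟨ n<2^n n ⟩
  2 ^ n          <⟨ m<m+n (2 ^ n) z<s ⟩
  2 ^ n + 1      ≤⟨ +-monoʳ-≤ (2 ^ n) (m^n>0 2 n) ⟩
  2 ^ n + 2 ^ n  ≡⟨ cong (_+_ (2 ^ n)) (+-identityʳ (2 ^ n)) ⟨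
  2 ^ suc n      ∎
  where open ≤-Reasoning

n*[1+n]≤2*2^n : ∀ n → n * suc n ≤ 2 * 2 ^ n
n*[1+n]≤2*2^n zero    = z≤n
n*[1+n]≤2*2^n (suc n) = begin
  suc n * suc (suc n)    ≡⟨ expand n ⟩
  n * suc n + 2 * suc n  ≤⟨ +-mono-≤ (n*[1+n]≤2*2^n n) (*-monoʳ-≤ 2 (n<2^n n)) ⟩
  2 * 2 ^ n + 2 * 2 ^ n  ≡⟨ cong (_+_ (2 * 2 ^ n)) (+-identityʳ (2 * 2 ^ n)) ⟨
  2 * 2 ^ suc n          ∎
  where
  open ≤-Reasoning
  expand : ∀ n → suc n * suc (suc n) ≡ n * suc n + 2 * suc n
  expand = solve-∀

∃≢ : ∀ {d} → 2 ≤ d → (j : Fin d) → ∃ (j ≢_)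
∃≢ (s≤s (s≤s _)) j = punchIn j zero , punchInᵢ≢i j zero ∘ sym

≡-at-and-off : ∀ {d} {v w : Vec A d} j → lookup v j ≡ lookup w j → (∀ i → i ≢ j → lookup v i ≡ lookup w i) → v ≡ w
≡-at-and-off {v = v} {w} j vⱼ≡wⱼ off = Pointwise-≡⇒≡ (ext agree)
  where
  agree : ∀ i → lookup v i ≡ lookup w i
  agree i with i Fin.≟ j
  ... | yes refl = vⱼ≡wⱼ
  ... | no i≢j   = off i i≢j

≡-replicate : ∀ {d} {v : Vec A d} {x} → (∀ i → lookup v i ≡ x) → v ≡ replicate d x
≡-replicate {x = x} vᵢ≡x = Pointwise-≡⇒≡ (ext λ i → trans (vᵢ≡x i) (sym (lookup-replicate i x)))

[]≔-injective : ∀ {d} {v w : Vec A d} i {x} → lookup v i ≡ lookup w i → v [ i ]≔ x ≡ w [ i ]≔ x → v ≡ w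
[]≔-injective {v = _ ∷ _} {_ ∷ _} zero    refl  eq = cong (_ ∷_) (∷-injectiveʳ eq)
[]≔-injective {v = _ ∷ _} {_ ∷ _} (suc i) vᵢ≡wᵢ eq = cong₂ _∷_ (∷-injectiveˡ eq) ([]≔-injective i vᵢ≡wᵢ (∷-injectiveʳ eq))

prodVec-[]≔1 : ∀ {d} (v : Vec ℕ d) i → prodVec (v [ i ]≔ 1) * lookup v i ≡ prodVec v
prodVec-[]≔1 (m ∷ v) zero    = trans (cong (_* m) (+-identityʳ (prodVec v))) (*-comm (prodVec v) m)
prodVec-[]≔1 (m ∷ v) (suc i) = trans (*-assoc m _ _) (cong (m *_) (prodVec-[]≔1 v i))

prodVec-map-mono : ∀ {d} {f g : ℕ → ℕ} → (∀ m → f m ≤ g m) → (v : Vec ℕ d) → prodVec (map f v) ≤ prodVec (map g v)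
prodVec-map-mono f≤g []      = ≤-refl
prodVec-map-mono f≤g (m ∷ v) = *-mono-≤ (f≤g m) (prodVec-map-mono f≤g v)

-- Integer boxes

atMost-interval : ∀ m → AtMost m (λ k → 0 < k × k ≤ m)
atMost-interval zero    = atMost-mono z≤n (λ { (() , z≤n) }) atMost-∅
atMost-interval (suc m) = atMost-⊆∪ split (atMost-｛｝ (suc m)) (atMost-interval m)
  where
  split : (λ k → 0 < k × k ≤ suc m) ⊆ ｛ suc m ｝ ∪ (λ k → 0 < k × k ≤ m)
  split (0<k , k≤1+m) with m≤n⇒m<n∨m≡n k≤1+m
  ... | inj₁ k<1+m = inj₂ (0<k , ≤-pred k<1+m)
  ... | inj₂ k≡1+m = inj₁ (sym k≡1+m)

atMost-*≤ : ∀ k m .{{_ : NonZero k}} → AtMost (m / k) (λ g → 0 < g × k * g ≤ m)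
atMost-*≤ k m = atMost-mono ≤-refl (λ (0<g , kg≤m) → 0<g , m*n≤o⇒n≤o/m k _ m kg≤m) (atMost-interval (m / k))

atMost-∣∣⁻¹ : {P : Pred ℕ 0ℓ} → AtMost N P → AtMost (N + N) (P ∘ ∣_∣)
atMost-∣∣⁻¹ {N = N} {P = P} #P = atMost-⊆∪ split (withSign Sign.+) (withSign Sign.-)
  where
  WithSign : Sign → Pred ℤ 0ℓ
  WithSign s z = sign z ≡ s × P ∣ z ∣
  withSign : ∀ s → AtMost N (WithSign s)
  withSign s = atMost-inject ∣_∣ inj proj₂ #P
    where
    inj : ∀ {x y} → WithSign s x → WithSign s y → ∣ x ∣ ≡ ∣ y ∣ → x ≡ y
    inj {x} {y} (refl , _) (sy , _) ∣x∣≡∣y∣ =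
      trans (sym (◃-inverse x)) (trans (cong₂ _◃_ (sym sy) ∣x∣≡∣y∣) (◃-inverse y))
  split : P ∘ ∣_∣ ⊆ WithSign Sign.+ ∪ WithSign Sign.-
  split {+ _}       p = inj₁ (refl , p)
  split { -[1+ _ ]} p = inj₂ (refl , p)

atMost-∣∣≤ : ∀ m → AtMost (suc (m + m)) (λ z → ∣ z ∣ ≤ m)
atMost-∣∣≤ m = atMost-⊆∪ split (atMost-｛｝ (+ 0)) (atMost-∣∣⁻¹ (atMost-interval m))
  where
  split : (λ z → ∣ z ∣ ≤ m) ⊆ ｛ + 0 ｝ ∪ (λ z → 0 < ∣ z ∣ × ∣ z ∣ ≤ m)
  split {+ zero}    _   = inj₁ refl
  split {+ suc _}   z≤m = inj₂ (s≤s z≤n , z≤m)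
  split { -[1+ _ ]} z≤m = inj₂ (s≤s z≤n , z≤m)

atMost-slopePairs : ∀ m l c .{{_ : NonZero m}} .{{_ : NonZero c}} →
                    AtMost (l + l) ((λ g → 0 < g × c * g ≤ m) ⟨×⟩ ((λ z → 0 < z × m * z ≤ l * c) ∘ ∣_∣))
atMost-slopePairs m l c = atMost-mono X*[Y+Y]≤2l (λ pair → pair)
  (atMost-Σ _≟_ (atMost-*≤ c m) λ _ → atMost-∣∣⁻¹ (atMost-*≤ m (l * c)))
  where
  X Y : ℕ
  X = m / c
  Y = l * c / m
  X*[Y+Y]≤2l : X * (Y + Y) ≤ l + l
  X*[Y+Y]≤2l = begin
    X * (Y + Y)    ≡⟨ *-distribˡ-+ X Y Y ⟩
    X * Y + X * Y  ≤⟨ +-mono-≤ ([m/n]*[o*n/m]≤o m c l) ([m/n]*[o*n/m]≤o m c l) ⟩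
    l + l          ∎
    where open ≤-Reasoning

InBox : ∀ {d} → Vec ℕ d → Pred (Vec ℤ d) 0ℓ
InBox u v = ∀ i → ∣ lookup v i ∣ ≤ lookup u i

boxSize : ∀ {d} → Vec ℕ d → ℕ
boxSize u = prodVec (map (λ m → suc (m + m)) u)

atMost-box : ∀ {d} (u : Vec ℕ d) → AtMost (boxSize u) (InBox u)
atMost-box []      = atMost-mono ≤-refl (λ { {[]} _ → refl }) (atMost-｛｝ [])
atMost-box (m ∷ u) = atMost-inject uncons uncons-injective (λ {v} → uncons-InBox {v})
  (atMost-Σ ℤ._≟_ (atMost-∣∣≤ m) (λ _ → atMost-box u))
  where
  uncons-injective : ∀ {v w} → InBox (m ∷ u) v → InBox (m ∷ u) w → uncons v ≡ uncons w → v ≡ w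
  uncons-injective {_ ∷ _} {_ ∷ _} _ _ refl = refl
  uncons-InBox : ∀ {v} → InBox (m ∷ u) v → ((λ z → ∣ z ∣ ≤ m) ⟨×⟩ InBox u) (uncons v)
  uncons-InBox {_ ∷ _} in-box = in-box zero , in-box ∘ suc

InBox-[]≔ : ∀ {d} {u : Vec ℕ d} {v} i {m z} → InBox u v → ∣ z ∣ ≤ m → InBox (u [ i ]≔ m) (v [ i ]≔ z)
InBox-[]≔ {u = _ ∷ _} {_ ∷ _} zero    in-box z≤m zero    = z≤m
InBox-[]≔ {u = _ ∷ _} {_ ∷ _} zero    in-box z≤m (suc l) = in-box (suc l)
InBox-[]≔ {u = _ ∷ _} {_ ∷ _} (suc i) in-box z≤m zero    = in-box zero
InBox-[]≔ {u = _ ∷ u} {_ ∷ v} (suc i) in-box z≤m (suc l) = InBox-[]≔ {u = u} {v} i (in-box ∘ suc) z≤m l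

-- Bounds the side 2m + 1 of a box by 3m, and is neutral on the coordinates that key zeroes out.
boxFactor : ℕ → ℕ
boxFactor zero    = 1
boxFactor (suc m) = 3 * suc m

1+2m≤boxFactor : ∀ m → suc (m + m) ≤ boxFactor m
1+2m≤boxFactor zero    = ≤-refl
1+2m≤boxFactor (suc m) = subst (suc (suc m + suc m) ≤_) (expand m) (m≤m+n _ m)
  where
  expand : ∀ m → suc (suc m + suc m) + m ≡ 3 * suc m
  expand = solve-∀

boxFactor-pos : ∀ {m} → 0 < m → boxFactor m ≡ 3 * m
boxFactor-pos {suc m} _ = refl

prodVec-boxFactor : ∀ {d} (v : Vec ℕ d) → (∀ i → 0 < lookup v i) → prodVec (map boxFactor v) ≡ 3 ^ d * prodVec v
prodVec-boxFactor []              _   = refl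
prodVec-boxFactor {suc d} (m ∷ v) v>0 = begin
  boxFactor m * prodVec (map boxFactor v)  ≡⟨ cong₂ _*_ (boxFactor-pos (v>0 zero)) (prodVec-boxFactor v (v>0 ∘ suc)) ⟩
  3 * m * (3 ^ d * prodVec v)              ≡⟨ interchange 3 m (3 ^ d) (prodVec v) ⟩
  3 * 3 ^ d * (m * prodVec v)              ∎
  where open ≡-Reasoning

prodVec-boxFactor>0 : ∀ {d} (v : Vec ℕ d) → 0 < prodVec (map boxFactor v)
prodVec-boxFactor>0 []      = s≤s z≤n
prodVec-boxFactor>0 (m ∷ v) = *-mono-≤ (≤-trans (s≤s z≤n) (1+2m≤boxFactor m)) (prodVec-boxFactor>0 v)

-- Primitive parts

gcdVec-∣ : ∀ {d} (b : Vec ℤ d) i → gcdVec b ∣ ∣ lookup b i ∣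
gcdVec-∣ (z ∷ b) zero    = gcd[m,n]∣m ∣ z ∣ (gcdVec b)
gcdVec-∣ (z ∷ b) (suc i) = ∣-trans (gcd[m,n]∣n ∣ z ∣ (gcdVec b)) (gcdVec-∣ b i)

gcdVec-nonZero : ∀ {d} (b : Vec ℤ d) → b ≢ replicate d (+ 0) → NonZero (gcdVec b)
gcdVec-nonZero b b≢0 with gcdVec b | gcdVec-∣ b
... | suc _ | _    = _
... | zero  | 0∣bᵢ = contradiction (≡-replicate λ i → ∣i∣≡0⇒i≡0 (0∣⇒≡0 (0∣bᵢ i))) b≢0

primitivePart : ∀ {d} → Vec ℤ d → Vec ℤ d
primitivePart b = tabulate λ i → sign (lookup b i) ◃ quotient (gcdVec-∣ b i)

module _ {d} (b : Vec ℤ d) (i : Fin d) where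

  private
    s : Sign
    s = sign (lookup b i)
    a : ℕ
    a = quotient (gcdVec-∣ b i)

  ∣primitivePart∣*gcd : ∣ lookup (primitivePart b) i ∣ * gcdVec b ≡ ∣ lookup b i ∣
  ∣primitivePart∣*gcd = begin
    ∣ lookup (primitivePart b) i ∣ * gcdVec b  ≡⟨ cong (λ z → ∣ z ∣ * gcdVec b) (lookup∘tabulate _ i) ⟩
    ∣ s ◃ a ∣ * gcdVec b                       ≡⟨ cong (_* gcdVec b) (abs-◃ s a) ⟩
    a * gcdVec b                               ≡⟨ _∣_.equality (gcdVec-∣ b i) ⟨
    ∣ lookup b i ∣                             ∎
    where open ≡-Reasoning

  primitivePart*gcd : lookup (primitivePart b) i ℤ.* + gcdVec b ≡ lookup b i
  primitivePart*gcd = begin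
    lookup (primitivePart b) i ℤ.* + gcdVec b  ≡⟨ cong₂ ℤ._*_ (lookup∘tabulate _ i) (sym (+◃n≡+n (gcdVec b))) ⟩
    (s ◃ a) ℤ.* (Sign.+ ◃ gcdVec b)            ≡⟨ ◃-distrib-* s Sign.+ a (gcdVec b) ⟨
    (s Sign.* Sign.+) ◃ (a * gcdVec b)         ≡⟨ cong₂ _◃_ (Sign.*-identityʳ s) (sym (_∣_.equality (gcdVec-∣ b i))) ⟩
    s ◃ ∣ lookup b i ∣                         ≡⟨ ◃-inverse (lookup b i) ⟩
    lookup b i                                 ∎
    where open ≡-Reasoning

primitivePart-injective : ∀ {d} {b c : Vec ℤ d} → gcdVec b ≡ gcdVec c → primitivePart b ≡ primitivePart c → b ≡ c
primitivePart-injective {b = b} {c} g≡ a≡ = Pointwise-≡⇒≡ (ext λ i → begin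
  lookup b i                                 ≡⟨ primitivePart*gcd b i ⟨
  lookup (primitivePart b) i ℤ.* + gcdVec b  ≡⟨ cong₂ (λ a g → lookup a i ℤ.* + g) a≡ g≡ ⟩
  lookup (primitivePart c) i ℤ.* + gcdVec c  ≡⟨ primitivePart*gcd c i ⟩
  lookup c i                                 ∎)
  where open ≡-Reasoning

-- Admissible points for ε = p / q

module AdmissiblePoints {d} (n : Vec ℕ d) (p q : ℕ) {{_ : NonZero q}} (q≤p*n : ∀ i → q ≤ p * lookup n i) where

  Admissible : Pred (Vec ℤ d) 0ℓ
  Admissible b = b ≢ replicate d (+ 0)
               × (∀ i → ∣ lookup b i ∣ ≤ lookup n i)
               × (∀ i → q * ∣ lookup b i ∣ ≤ p * lookup n i * gcdVec b)

  ∣b/g∣ : Vec ℤ d → Fin d → ℕ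
  ∣b/g∣ b i = ∣ lookup (primitivePart b) i ∣

  n>0 : ∀ i → 0 < lookup n i
  n>0 i = n≢0⇒n>0 λ nᵢ≡0 → <⇒≱ (>-nonZero⁻¹ q) (subst (q ≤_) (trans (cong (p *_) nᵢ≡0) (*-zeroʳ p)) (q≤p*n i))

  private instance
    9q≢0 : NonZero (9 * q)
    9q≢0 = m*n≢0 9 q

  pieceBound : ℕ
  pieceBound = 4 * (p * (3 ^ d * prodVec n)) / (9 * q)

  module _ {b} (adm : Admissible b) where

    instance
      gcd≢0 : NonZero (gcdVec b)
      gcd≢0 = gcdVec-nonZero b (proj₁ adm)

    q*∣b/g∣≤p*n : ∀ i → q * ∣b/g∣ b i ≤ p * lookup n i
    q*∣b/g∣≤p*n i = *-cancelʳ-≤ _ _ (gcdVec b) (begin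
      q * ∣b/g∣ b i * gcdVec b    ≡⟨ *-assoc q _ _ ⟩
      q * (∣b/g∣ b i * gcdVec b)  ≡⟨ cong (q *_) (∣primitivePart∣*gcd b i) ⟩
      q * ∣ lookup b i ∣          ≤⟨ proj₂ (proj₂ adm) i ⟩
      p * lookup n i * gcdVec b   ∎)
      where open ≤-Reasoning

    ∣b/g∣*g≤n : ∀ i → ∣b/g∣ b i * gcdVec b ≤ lookup n i
    ∣b/g∣*g≤n i = subst (_≤ lookup n i) (sym (∣primitivePart∣*gcd b i)) (proj₁ (proj₂ adm) i)

    ∣b/g∣≤n : ∀ i → ∣b/g∣ b i ≤ lookup n i
    ∣b/g∣≤n i = ≤-trans (m≤m*n (∣b/g∣ b i) (gcdVec b)) (∣b/g∣*g≤n i)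

    ∣b/g∣>0 : ∀ i → lookup b i ≢ + 0 → 0 < ∣b/g∣ b i
    ∣b/g∣>0 i bᵢ≢0 = n≢0⇒n>0 λ ∣b/g∣≡0 → bᵢ≢0 (∣i∣≡0⇒i≡0 (begin
      ∣ lookup b i ∣        ≡⟨ ∣primitivePart∣*gcd b i ⟨
      ∣b/g∣ b i * gcdVec b  ≡⟨ cong (_* gcdVec b) ∣b/g∣≡0 ⟩
      0                     ∎))
      where open ≡-Reasoning

  OnAxis : Fin d → Pred (Vec ℤ d) 0ℓ
  OnAxis j b = Admissible b × (∀ i → i ≢ j → lookup b i ≡ + 0)

  atMost-OnAxis : ∀ j → AtMost (lookup n j + lookup n j) (OnAxis j)
  atMost-OnAxis j = atMost-inject (λ b → lookup b j) inj range (atMost-∣∣⁻¹ (atMost-interval (lookup n j)))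
    where
    inj : ∀ {b c} → OnAxis j b → OnAxis j c → lookup b j ≡ lookup c j → b ≡ c
    inj (_ , b₀) (_ , c₀) bⱼ≡cⱼ = ≡-at-and-off j bⱼ≡cⱼ λ i i≢j → trans (b₀ i i≢j) (sym (c₀ i i≢j))
    range : ∀ {b} → OnAxis j b → 0 < ∣ lookup b j ∣ × ∣ lookup b j ∣ ≤ lookup n j
    range {b} ((b≢0 , ∣b∣≤n , _) , b₀) = n≢0⇒n>0 (bⱼ≢0 ∘ ∣i∣≡0⇒i≡0) , ∣b∣≤n j
      where
      bⱼ≢0 : lookup b j ≢ + 0
      bⱼ≢0 bⱼ≡0 = b≢0 (≡-at-and-off j (trans bⱼ≡0 (sym (lookup-replicate j (+ 0))))
                                      λ i i≢j → trans (b₀ i i≢j) (sym (lookup-replicate i (+ 0))))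

  Dominates : Fin d → Fin d → Pred (Vec ℤ d) 0ℓ
  Dominates j k b = Admissible b × j ≢ k × 0 < ∣b/g∣ b j × 0 < ∣b/g∣ b k
                  × lookup n j * ∣b/g∣ b k ≤ lookup n k * ∣b/g∣ b j

  cover : Admissible ⊆ ⋃ (Fin d) λ j → OnAxis j ∪ ⋃ (Fin d) (Dominates j)
  cover {b} adm with ¬∀⟶∃¬ d (λ i → lookup b i ≡ + 0) (λ i → lookup b i ℤ.≟ + 0) (proj₁ adm ∘ ≡-replicate)
  ... | j , bⱼ≢0 with any? (λ k → ¬? (k Fin.≟ j) ×-dec ¬? (lookup b k ℤ.≟ + 0))
  ... | no ¬other = j , inj₁ (adm , λ i i≢j → decidable-stable (lookup b i ℤ.≟ + 0) λ bᵢ≢0 → ¬other (i , i≢j , bᵢ≢0))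
  ... | yes (k , k≢j , bₖ≢0) with ≤-total (lookup n j * ∣b/g∣ b k) (lookup n k * ∣b/g∣ b j)
  ...   | inj₁ slope = j , inj₂ (k , adm , k≢j ∘ sym , ∣b/g∣>0 adm j bⱼ≢0 , ∣b/g∣>0 adm k bₖ≢0 , slope)
  ...   | inj₂ slope = k , inj₂ (j , adm , k≢j , ∣b/g∣>0 adm k bₖ≢0 , ∣b/g∣>0 adm j bⱼ≢0 , slope)

  module _ {j k : Fin d} (j≢k : j ≢ k) where

    offAxes : Vec ℕ d
    offAxes = (n [ j ]≔ 0) [ k ]≔ 0

    key : Vec ℤ d → ℤ × (ℕ × ℤ) × Vec ℤ d
    key b = lookup a j , (gcdVec b , lookup a k) , (a [ j ]≔ + 0) [ k ]≔ + 0
      where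
      a : Vec ℤ d
      a = primitivePart b

    KeyRange : Pred (ℤ × (ℕ × ℤ) × Vec ℤ d) 0ℓ
    KeyRange = ((λ m → 0 < m × q * m ≤ p * lookup n j) ∘ ∣_∣)
               ⟨Σ⟩ λ c → ((λ g → 0 < g × ∣ c ∣ * g ≤ lookup n j)
                          ⟨×⟩ ((λ m → 0 < m × lookup n j * m ≤ lookup n k * ∣ c ∣) ∘ ∣_∣))
                         ⟨×⟩ InBox offAxes

    private
      Mⱼ : ℕ
      Mⱼ = p * lookup n j / q

    dominatesBound : ℕ
    dominatesBound = (Mⱼ + Mⱼ) * ((lookup n k + lookup n k) * boxSize offAxes)

    atMost-KeyRange : AtMost dominatesBound KeyRange
    atMost-KeyRange = atMost-Σ ℤ._≟_ (atMost-∣∣⁻¹ (atMost-*≤ q (p * lookup n j))) λ {c} (∣c∣>0 , _) →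
      atMost-Σ (Product.≡-dec _≟_ ℤ._≟_)
               (atMost-slopePairs (lookup n j) (lookup n k) ∣ c ∣ {{>-nonZero (n>0 j)}} {{>-nonZero ∣c∣>0}})
               λ _ → atMost-box offAxes

    atMost-Dominates : AtMost dominatesBound (Dominates j k)
    atMost-Dominates = atMost-inject key inj range atMost-KeyRange
      where
      inj : ∀ {b c} → Dominates j k b → Dominates j k c → key b ≡ key c → b ≡ c
      inj {b} {c} _ _ key≡ = primitivePart-injective (cong (proj₁ ∘ proj₁ ∘ proj₂) key≡)
        ([]≔-injective j (cong proj₁ key≡) ([]≔-injective k aₖ≡ (cong (proj₂ ∘ proj₂) key≡)))
        where
        aₖ≡ : lookup (primitivePart b [ j ]≔ + 0) k ≡ lookup (primitivePart c [ j ]≔ + 0) k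
        aₖ≡ = trans (lookup∘update′ (j≢k ∘ sym) (primitivePart b) (+ 0))
                (trans (cong (proj₂ ∘ proj₁ ∘ proj₂) key≡) (sym (lookup∘update′ (j≢k ∘ sym) (primitivePart c) (+ 0))))
      range : ∀ {b} → Dominates j k b → KeyRange (key b)
      range {b} (adm , _ , aⱼ>0 , aₖ>0 , slope) =
        (aⱼ>0 , q*∣b/g∣≤p*n adm j) ,
        ((>-nonZero⁻¹ (gcdVec b) {{gcd≢0 adm}} , ∣b/g∣*g≤n adm j) , (aₖ>0 , slope)) ,
        InBox-[]≔ {u = n [ j ]≔ 0} {primitivePart b [ j ]≔ + 0} k
          (InBox-[]≔ {u = n} {primitivePart b} j (∣b/g∣≤n adm) z≤n) z≤n

    boxFactor-offAxes : prodVec (map boxFactor offAxes) * (3 * lookup n k) * (3 * lookup n j) ≡ 3 ^ d * prodVec n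
    boxFactor-offAxes = begin
      prodVec (map boxFactor offAxes) * (3 * lookup n k) * (3 * lookup n j)
        ≡⟨ cong₂ (λ v x → prodVec v * x * (3 * lookup n j)) map-offAxes (sym Fⱼ[k]≡3nₖ) ⟩
      prodVec ((F [ j ]≔ 1) [ k ]≔ 1) * lookup (F [ j ]≔ 1) k * (3 * lookup n j)
        ≡⟨ cong₂ _*_ (prodVec-[]≔1 (F [ j ]≔ 1) k) (sym (F≡3n j)) ⟩
      prodVec (F [ j ]≔ 1) * lookup F j
        ≡⟨ prodVec-[]≔1 F j ⟩
      prodVec F
        ≡⟨ prodVec-boxFactor n n>0 ⟩
      3 ^ d * prodVec n ∎
      where
      open ≡-Reasoning
      F = map boxFactor n
      F≡3n : ∀ i → lookup F i ≡ 3 * lookup n i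
      F≡3n i = trans (lookup-map i boxFactor n) (boxFactor-pos (n>0 i))
      Fⱼ[k]≡3nₖ : lookup (F [ j ]≔ 1) k ≡ 3 * lookup n k
      Fⱼ[k]≡3nₖ = trans (lookup∘update′ (j≢k ∘ sym) F 1) (F≡3n k)
      map-offAxes : map boxFactor offAxes ≡ (F [ j ]≔ 1) [ k ]≔ 1
      map-offAxes = trans (map-[]≔ boxFactor (n [ j ]≔ 0) k) (cong (_[ k ]≔ 1) (map-[]≔ boxFactor n j))

    private
      F′ 3nₖ 3nⱼ : ℕ
      F′ = prodVec (map boxFactor offAxes)
      3nₖ = 3 * lookup n k
      3nⱼ = 3 * lookup n j

    2nⱼ≤pieceBound : lookup n j + lookup n j ≤ pieceBound
    2nⱼ≤pieceBound = m*n≤o⇒n≤o/m (9 * q) _ _ (begin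
      9 * q * (lookup n j + lookup n j)        ≡⟨ rearrange q (lookup n j) ⟩
      2 * (q * (9 * lookup n j))               ≤⟨ *-monoʳ-≤ 2 (*-monoˡ-≤ (9 * lookup n j) (q≤p*n k)) ⟩
      2 * (p * lookup n k * (9 * lookup n j))  ≡⟨ cong (2 *_) (regroup p (lookup n k) (lookup n j)) ⟩
      2 * (p * (1 * 3nₖ * 3nⱼ))                ≤⟨ *-monoʳ-≤ 2 (*-monoʳ-≤ p (*-monoˡ-≤ 3nⱼ (*-monoˡ-≤ 3nₖ (prodVec-boxFactor>0 offAxes)))) ⟩
      2 * (p * (F′ * 3nₖ * 3nⱼ))               ≡⟨ cong (λ x → 2 * (p * x)) boxFactor-offAxes ⟩
      2 * (p * (3 ^ d * prodVec n))            ≤⟨ *-monoˡ-≤ (p * (3 ^ d * prodVec n)) (s≤s (s≤s (z≤n {2}))) ⟩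
      4 * (p * (3 ^ d * prodVec n))            ∎)
      where
      open ≤-Reasoning
      rearrange : ∀ q m → 9 * q * (m + m) ≡ 2 * (q * (9 * m))
      rearrange = solve-∀
      regroup : ∀ p m l → p * m * (9 * l) ≡ p * (1 * (3 * m) * (3 * l))
      regroup = solve-∀

    dominatesBound≤pieceBound : dominatesBound ≤ pieceBound
    dominatesBound≤pieceBound = m*n≤o⇒n≤o/m (9 * q) _ _ (begin
      9 * q * ((Mⱼ + Mⱼ) * ((lookup n k + lookup n k) * S))  ≡⟨ rearrange q Mⱼ (lookup n k) S ⟩
      4 * (q * Mⱼ * (S * 3nₖ * 3))                          ≤⟨ *-monoʳ-≤ 4 (*-monoˡ-≤ (S * 3nₖ * 3) q*M≤p*nⱼ) ⟩
      4 * (p * lookup n j * (S * 3nₖ * 3))                 ≡⟨ cong (4 *_) (regroup p (lookup n j) S 3nₖ) ⟩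
      4 * (p * (S * 3nₖ * 3nⱼ))                            ≤⟨ *-monoʳ-≤ 4 (*-monoʳ-≤ p (*-monoˡ-≤ 3nⱼ (*-monoˡ-≤ 3nₖ S≤F′))) ⟩
      4 * (p * (F′ * 3nₖ * 3nⱼ))                           ≡⟨ cong (λ x → 4 * (p * x)) boxFactor-offAxes ⟩
      4 * (p * (3 ^ d * prodVec n))                        ∎)
      where
      open ≤-Reasoning
      S : ℕ
      S = boxSize offAxes
      q*M≤p*nⱼ : q * Mⱼ ≤ p * lookup n j
      q*M≤p*nⱼ = subst (_≤ p * lookup n j) (*-comm Mⱼ q) (m/n*n≤m (p * lookup n j) q)
      S≤F′ : S ≤ F′
      S≤F′ = prodVec-map-mono 1+2m≤boxFactor offAxes
      rearrange : ∀ q x m S → 9 * q * ((x + x) * ((m + m) * S)) ≡ 4 * (q * x * (S * (3 * m) * 3))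
      rearrange = solve-∀
      regroup : ∀ p l S x → p * l * (S * x * 3) ≡ p * (S * x * (3 * l))
      regroup = solve-∀

  totalBound : ℕ
  totalBound = d * (pieceBound + d * pieceBound)

  atMost-Admissible : 2 ≤ d → AtMost totalBound Admissible
  atMost-Admissible 2≤d = atMost-mono ≤-refl cover (atMost-⋃ d λ j → atMost-∪ (onAxis j) (atMost-⋃ d (dominates j)))
    where
    onAxis : ∀ j → AtMost pieceBound (OnAxis j)
    onAxis j = atMost-mono (2nⱼ≤pieceBound (proj₂ (∃≢ 2≤d j))) (λ x → x) (atMost-OnAxis j)
    dominates : ∀ j k → AtMost pieceBound (Dominates j k)
    dominates j k with j Fin.≟ k
    ... | yes refl = atMost-mono z≤n (λ (_ , j≢j , _) → j≢j refl) atMost-∅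
    ... | no j≢k   = atMost-mono (dominatesBound≤pieceBound j≢k) (λ x → x) (atMost-Dominates j≢k)

  q*totalBound≤6^d*p*∏n : q * totalBound ≤ 6 ^ d * (p * prodVec n)
  q*totalBound≤6^d*p*∏n = *-cancelˡ-≤ 9 (begin
    9 * (q * (d * (P₀ + d * P₀)))         ≡⟨ rearrange q d P₀ ⟩
    d * suc d * (P₀ * (9 * q))            ≤⟨ *-monoʳ-≤ (d * suc d) (m/n*n≤m (4 * (p * V)) (9 * q)) ⟩
    d * suc d * (4 * (p * V))             ≤⟨ *-monoˡ-≤ (4 * (p * V)) (n*[1+n]≤2*2^n d) ⟩
    2 * 2 ^ d * (4 * (p * (3 ^ d * ∏n)))  ≡⟨ regroup (2 ^ d) (3 ^ d) p ∏n ⟩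
    8 * (2 ^ d * 3 ^ d * (p * ∏n))        ≡⟨ cong (λ x → 8 * (x * (p * ∏n))) (^-distribʳ-* 2 3 d) ⟨
    8 * (6 ^ d * (p * ∏n))                ≤⟨ *-monoˡ-≤ (6 ^ d * (p * ∏n)) (n≤1+n 8) ⟩
    9 * (6 ^ d * (p * ∏n))                ∎)
    where
    open ≤-Reasoning
    P₀ ∏n V : ℕ
    P₀ = pieceBound
    ∏n = prodVec n
    V = 3 ^ d * ∏n
    rearrange : ∀ q d x → 9 * (q * (d * (x + d * x))) ≡ d * suc d * (x * (9 * q))
    rearrange = solve-∀
    regroup : ∀ x y p m → 2 * x * (4 * (p * (y * m))) ≡ 8 * (x * y * (p * m))
    regroup = solve-∀

module _ {x y : ℚᵘ} {a b c e : ℕ} (↥x≡a : ↥ x ≡ + a) (↧x≡b : ↧ₙ x ≡ b) (↥y≡c : ↥ y ≡ + c) (↧y≡e : ↧ₙ y ≡ e) where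

  private
    ↥x↧y≡ : ↥ x ℤ.* ℚᵘ.↧ y ≡ + (a * e)
    ↥x↧y≡ = trans (cong₂ ℤ._*_ ↥x≡a (cong +_ ↧y≡e)) (sym (pos-* a e))
    ↥y↧x≡ : ↥ y ℤ.* ℚᵘ.↧ x ≡ + (c * b)
    ↥y↧x≡ = trans (cong₂ ℤ._*_ ↥y≡c (cong +_ ↧x≡b)) (sym (pos-* c b))

  ≤ᵘ⇒ℕ : x ℚᵘ.≤ y → a * e ≤ c * b
  ≤ᵘ⇒ℕ (*≤* le) = drop‿+≤+ (subst₂ ℤ._≤_ ↥x↧y≡ ↥y↧x≡ le)

  ℕ⇒≤ᵘ : a * e ≤ c * b → x ℚᵘ.≤ y
  ℕ⇒≤ᵘ le = *≤* (subst₂ ℤ._≤_ (sym ↥x↧y≡) (sym ↥y↧x≡) (+≤+ le))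

toℚᵘ-ℕtoℚ : ∀ m → toℚᵘ (ℕtoℚ m) ℚᵘ.≃ mkℚᵘ (+ m) 0
toℚᵘ-ℕtoℚ m = toℚᵘ-fromℚᵘ (mkℚᵘ (+ m) 0)

module _ (p′ q′ : ℕ) .(coprime : Coprime (suc p′) (suc q′)) where

  private
    ε : ℚ
    ε = mkℚ (+ suc p′) q′ coprime
    εᵘ : ℚᵘ
    εᵘ = mkℚᵘ (+ suc p′) q′

  inv≤ℕtoℚ⇒ : ∀ ε>0 m → inv ε ε>0 ℚ.≤ ℕtoℚ m → suc q′ ≤ suc p′ * m
  inv≤ℕtoℚ⇒ _ m h = subst₂ _≤_ (*-identityʳ (suc q′)) (*-comm m (suc p′))
    (≤ᵘ⇒ℕ refl refl refl refl (ℚᵘ.≤-respʳ-≃ (toℚᵘ-ℕtoℚ m) (toℚᵘ-mono-≤ h)))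

  divℚ≤ε*ℕtoℚ⇒ : ∀ a g m .{{_ : NonZero g}} → divℚ a g ℚ.≤ ε ℚ.* ℕtoℚ m → suc q′ * a ≤ suc p′ * m * g
  divℚ≤ε*ℕtoℚ⇒ a (suc g) m h = subst (_≤ suc p′ * m * suc g) (*-comm a (suc q′))
    (≤ᵘ⇒ℕ refl refl (sym (pos-* (suc p′) m)) (cong suc (*-identityʳ q′))
      (ℚᵘ.≤-respˡ-≃ (toℚᵘ-fromℚᵘ (mkℚᵘ (+ a) g)) (ℚᵘ.≤-respʳ-≃ ε*m≃ (toℚᵘ-mono-≤ h))))
    where
    ε*m≃ : toℚᵘ (ε ℚ.* ℕtoℚ m) ℚᵘ.≃ εᵘ ℚᵘ.* mkℚᵘ (+ m) 0
    ε*m≃ = ℚᵘ.≃-trans (toℚᵘ-homo-* ε (ℕtoℚ m)) (ℚᵘ.*-congˡ {εᵘ} (toℚᵘ-ℕtoℚ m))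

  ℕ⇒≤ℕtoℚ*ε*ℕtoℚ : ∀ l K P → suc q′ * l ≤ K * (suc p′ * P) → ℕtoℚ l ℚ.≤ ℕtoℚ K ℚ.* ε ℚ.* ℕtoℚ P
  ℕ⇒≤ℕtoℚ*ε*ℕtoℚ l K P le = toℚᵘ-cancel-≤ (ℚᵘ.≤-respˡ-≃ (ℚᵘ.≃-sym (toℚᵘ-ℕtoℚ l)) (ℚᵘ.≤-respʳ-≃ (ℚᵘ.≃-sym K*ε*P≃)
    (ℕ⇒≤ᵘ refl refl ↥≡ (cong suc (trans (*-identityʳ _) (+-identityʳ q′)))
      (subst₂ _≤_ (*-comm (suc q′) l) (sym (*-identityʳ _)) le))))
    where
    Kᵘ : ℚᵘ
    Kᵘ = mkℚᵘ (+ K) 0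
    K*ε*P≃ : toℚᵘ (ℕtoℚ K ℚ.* ε ℚ.* ℕtoℚ P) ℚᵘ.≃ Kᵘ ℚᵘ.* εᵘ ℚᵘ.* mkℚᵘ (+ P) 0
    K*ε*P≃ = ℚᵘ.≃-trans (toℚᵘ-homo-* (ℕtoℚ K ℚ.* ε) (ℕtoℚ P))
      (ℚᵘ.*-cong (ℚᵘ.≃-trans (toℚᵘ-homo-* (ℕtoℚ K) ε) (ℚᵘ.*-congʳ {εᵘ} (toℚᵘ-ℕtoℚ K))) (toℚᵘ-ℕtoℚ P))
    ↥≡ : ↥ (Kᵘ ℚᵘ.* εᵘ ℚᵘ.* mkℚᵘ (+ P) 0) ≡ + (K * (suc p′ * P))
    ↥≡ = trans (cong (ℤ._* + P) (sym (pos-* K (suc p′))))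
           (trans (sym (pos-* (K * suc p′) P)) (cong +_ (*-assoc K (suc p′) P)))

lemma4p9 : (d : ℕ) → 2 ℕ.≤ d → (n : Vec ℕ d) → (ε : ℚ) → (ε>0 : 0ℚ ℚ.< ε) → ε ℚ.< 1ℚ →
  (∀ i → inv ε ε>0 ℚ.≤ ℕtoℚ (lookup n i)) →
  (L : List (Vec ℤ d)) → Unique L →
  All (λ b → (b ≢ replicate d (+ 0))
             × (∀ i → ∣ lookup b i ∣ ℕ.≤ lookup n i)
             × (∀ i → divℚ ∣ lookup b i ∣ (gcdVec b) ℚ.≤ ε ℚ.* ℕtoℚ (lookup n i))) L →
  ℕtoℚ (length L) ℚ.≤ ℕtoℚ (6 ℕ.^ d) ℚ.* ε ℚ.* ℕtoℚ (prodVec n)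
lemma4p9 d 2≤d n (mkℚ (+ zero) _ _)    (*<* (ℤ.+<+ ())) _ _ _ _ _
lemma4p9 d 2≤d n (mkℚ -[1+ _ ] _ _)    (*<* ())         _ _ _ _ _
lemma4p9 d 2≤d n ε@(mkℚ (+ suc p′) q′ c) ε>0 _ 1/ε≤n L unique points =
  ℕ⇒≤ℕtoℚ*ε*ℕtoℚ p′ q′ c (length L) (6 ^ d) (prodVec n) (begin
    suc q′ * length L      ≤⟨ *-monoʳ-≤ (suc q′) (atMost-Admissible 2≤d unique (All.map admissible points)) ⟩
    suc q′ * totalBound    ≤⟨ q*totalBound≤6^d*p*∏n ⟩
    6 ^ d * (suc p′ * prodVec n) ∎)
  where
  open ≤-Reasoning
  open AdmissiblePoints n (suc p′) (suc q′) (λ i → inv≤ℕtoℚ⇒ p′ q′ c ε>0 (lookup n i) (1/ε≤n i))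
  admissible : ∀ {b} → (b ≢ replicate d (+ 0)) × (∀ i → ∣ lookup b i ∣ ≤ lookup n i)
                       × (∀ i → divℚ ∣ lookup b i ∣ (gcdVec b) ℚ.≤ ε ℚ.* ℕtoℚ (lookup n i)) → Admissible b
  admissible {b} (b≢0 , ∣b∣≤n , ∣b/g∣≤εn) =
    b≢0 , ∣b∣≤n , λ i → divℚ≤ε*ℕtoℚ⇒ p′ q′ c _ (gcdVec b) (lookup n i) {{gcdVec-nonZero b b≢0}} (∣b/g∣≤εn i)
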